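{- In $\mathbf{S}$, for all formulas $A,B,C\in\mathsf{Form}_\supset$: $\{A\supset B,\ B\supset C\}\vdash A\supset C$.
   Context: Formulas $\mathsf{Form}_\supset$ are built from a countable set of propositional variables using binary connectives $\land,\lor,\to,\supset$. The proof system $\mathbf{S}$ has axiom schemata (for all formulas $A,B,C$) (Ax1) $A\to(B\to A)$; (Ax2) $(A\to(B\to C))\to((A\to B)\to(A\to C))$; (Ax3) $(A\land B)\to A$; (Ax4) $(A\land B)\to B$; (Ax5) $(C\to A)\to((C\to B)\to(C\to(A\land B)))$; (Ax6) $A\to(A\lor B)$; (Ax7) $B\to(A\lor B)$; (Ax8) $(A\to C)\to((B\to C)\to((A\lor B)\to C))$; (AxM1) $(A\to B)\supset(A\supset B)$; (AxM2) $(A\supset(B\supset C))\to((A\supset B)\supset(A\supset C))$; (AxM3) $(A\supset(B\to C))\to(B\to(A\supset C))$; (AxM4) $(A\to(B\supset C))\to(B\supset(A\to C))$; (AxM5) $((A\supset B)\supset C)\to((A\supset C)\to C)$; (AxM6) $(A\supset C)\to((B\supset C)\to((A\lor B)\supset C))$; and the single rule (MP): from $A$ and $A\supset B$ infer $B$. $\Gamma\vdash A$ iff there is a finite sequence ending in $A$ each member of which is in $\Gamma$, an axiom instance, or obtained by (MP) from earlier members. -}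

module Defs where

open import Data.Nat using (ℕ)
open import Data.List using (List; _∷_; [])
open import Data.List.Membership.Propositional using (_∈_)

infixr 6 _∧_
infixr 5 _∨_
infixr 4 _⇒_ _⊃_

-- Formulas over countably many propositional variables (indexed by ℕ)
-- with binary connectives ∧, ∨, → (written _⇒_) and ⊃.
data Form : Set where
  var : ℕ → Form
  _∧_ : Form → Form → Form
  _∨_ : Form → Form → Form
  _⇒_ : Form → Form → Form
  _⊃_ : Form → Form → Form

data Axiom : Form → Set where
  ax1  : ∀ A B → Axiom (A ⇒ (B ⇒ A))
  ax2  : ∀ A B C → Axiom ((A ⇒ (B ⇒ C)) ⇒ ((A ⇒ B) ⇒ (A ⇒ C)))
  ax3  : ∀ A B → Axiom ((A ∧ B) ⇒ A)
  ax4  : ∀ A B → Axiom ((A ∧ B) ⇒ B)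
  ax5  : ∀ A B C → Axiom ((C ⇒ A) ⇒ ((C ⇒ B) ⇒ (C ⇒ (A ∧ B))))
  ax6  : ∀ A B → Axiom (A ⇒ (A ∨ B))
  ax7  : ∀ A B → Axiom (B ⇒ (A ∨ B))
  ax8  : ∀ A B C → Axiom ((A ⇒ C) ⇒ ((B ⇒ C) ⇒ ((A ∨ B) ⇒ C)))
  axM1 : ∀ A B → Axiom ((A ⇒ B) ⊃ (A ⊃ B))
  axM2 : ∀ A B C → Axiom ((A ⊃ (B ⊃ C)) ⇒ ((A ⊃ B) ⊃ (A ⊃ C)))
  axM3 : ∀ A B C → Axiom ((A ⊃ (B ⇒ C)) ⇒ (B ⇒ (A ⊃ C)))
  axM4 : ∀ A B C → Axiom ((A ⇒ (B ⊃ C)) ⇒ (B ⊃ (A ⇒ C)))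
  axM5 : ∀ A B C → Axiom (((A ⊃ B) ⊃ C) ⇒ ((A ⊃ C) ⇒ C))
  axM6 : ∀ A B C → Axiom ((A ⊃ C) ⇒ ((B ⊃ C) ⇒ ((A ∨ B) ⊃ C)))

-- Derivability from a set of premises Γ (a predicate on formulas);
-- the inductive closure is equivalent to the existence of a finite
-- derivation sequence.
infix 2 _⊢_
data _⊢_ (Γ : Form → Set) : Form → Set where
  hyp : ∀ {A} → Γ A → Γ ⊢ A
  ax  : ∀ {A} → Axiom A → Γ ⊢ A
  mp  : ∀ {A B} → Γ ⊢ A → Γ ⊢ (A ⊃ B) → Γ ⊢ B

⟦_⟧ : List Form → Form → Set
⟦ xs ⟧ A = A ∈ xs

module Submission where

open import Defs
open import Data.List using (List; _∷_; [])
open import Data.List.Relation.Unary.Any using (here; there)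
open import Relation.Binary.PropositionalEquality using (refl)

-- Since MP only fires on ⊃, every ⇒-axiom is first turned into a ⊃ by AxM1;
-- Ax1 then gives A ⊃ (B ⊃ C), and AxM2 distributes it over A ⊃ B.

⇒-to-⊃ : ∀ {Γ A B} → Γ ⊢ A ⇒ B → Γ ⊢ A ⊃ B
⇒-to-⊃ {A = A} {B} d = mp d (ax (axM1 A B))

⊃-weaken : ∀ {Γ B} A → Γ ⊢ B → Γ ⊢ A ⊃ B
⊃-weaken {B = B} A d = ⇒-to-⊃ (mp d (⇒-to-⊃ (ax (ax1 B A))))

⊃-distrib : ∀ {Γ A B C} → Γ ⊢ A ⊃ (B ⊃ C) → Γ ⊢ (A ⊃ B) ⊃ (A ⊃ C)
⊃-distrib {A = A} {B} {C} d = mp d (⇒-to-⊃ (ax (axM2 A B C)))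

⊃-trans : ∀ {Γ A B C} → Γ ⊢ A ⊃ B → Γ ⊢ B ⊃ C → Γ ⊢ A ⊃ C
⊃-trans {A = A} ab bc = mp ab (⊃-distrib (⊃-weaken A bc))

mainTheorem6 : ∀ (A B C : Form) → ⟦ (A ⊃ B) ∷ (B ⊃ C) ∷ [] ⟧ ⊢ (A ⊃ C)
mainTheorem6 A B C = ⊃-trans (hyp (here refl)) (hyp (there (here refl)))
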